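{- For every prime $p\geq 7$, \[ \binom{2p}{p}\, b_{p-1}\equiv 2\pmod{p^5}, \] where $b_n$ denotes the $n$-th Apéry number.
   Context: The Apéry numbers are $b_n=\sum_{k=0}^n\binom{n}{k}^2\binom{n+k}{k}^2$ for $n\geq 0$ (equivalently $b_0=1$, $b_1=5$, $b_n=\frac{34n^3-51n^2+27n-5}{n^3}b_{n-1}-\frac{(n-1)^3}{n^3}b_{n-2}$ for $n\geq2$). For rationals $x,y$, $x\equiv y\pmod{p^5}$ means the numerator of $x-y$ is divisible by $p^5$. -}

module Defs where

open import Data.Nat using (ℕ; zero; suc; _+_; _*_; _^_)
open import Data.Nat.Combinatorics using (_C_)
open import Data.List using (map; upTo)
open import Data.Nat.ListAction using (sum)

apery : ℕ → ℕ
apery n = sum (map (λ k → ((n C k) ^ 2) * (((n + k) C k) ^ 2)) (upTo (suc n)))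

module Submission where

-- Write p = 2m + 1, n = p − 1 and let 1/k denote an inverse of k modulo p⁵. Pascal-type recurrences
-- write C(p + n, n) = C(2p, p)/2 as ∏_{k ≤ n} (1 + p/k), and the square root C(n, k) C(n + k, k) of
-- the k-th Apéry summand as ± (p/k) (1 − p/k) ∏_{j < k} (1 − p²/j²). Expanding modulo p⁵ gives
--   C(p + n, n) ≡ 1 − p² H₂ + p⁴ e₂   and   b_n ≡ 1 + p² H₂ − 2p³ H₃ + p⁴ H₄ − 2p⁴ e₂,
-- with H_r = ∑_{k<p} 1/k^r and e₂ = ∑_{j<k<p} 1/(j²k²). Since k ↦ 2k permutes the units modulo p,
-- 2^r H_r ≡ H_r, so H₂ ≡ H₄ ≡ 0 (mod p) as p ∤ 3 · 5; pairing k with p − k gives 2H₃ ≡ −3p H₄ ≡ 0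
-- (mod p²); and 2e₂ = H₂² − H₄ ≡ 0 (mod p). Hence C(2p, p) b_n ≡ 2 (1 − p² H₂)(1 + p² H₂) ≡ 2 (mod p⁵).

open import Algebra.Bundles using (CommutativeMonoid)
open import Data.Nat as ℕ using (ℕ; zero; suc; pred; _≤_; _<_; z≤n; s≤s; _∸_)
import Data.Nat.Properties as ℕ
import Data.Nat.Tactic.RingSolver as ℕ-Solver
import Data.Nat.Divisibility as ℕ∣
open import Data.Nat.Combinatorics using (_C_; nC1≡n; nCk+nC[k+1]≡[n+1]C[k+1])
open import Data.Nat.Coprimality using (Coprime; coprime⇒GCD≡1; prime⇒coprime)
import Data.Nat.Coprimality as Coprimality
open import Data.Nat.GCD using (module GCD; module Bézout)
open import Data.Nat.Primality using (Prime; prime⇒irreducible)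
open import Data.Product using (_,_; ∃-syntax)
open import Data.Sum using (_⊎_; inj₁; inj₂)
open import Level using (0ℓ)
open import Relation.Binary.Bundles using (Setoid)
open import Relation.Binary.Core using (Rel; _Preserves₂_⟶_⟶_)
open import Relation.Binary.Definitions using (Reflexive)
open import Relation.Binary.PropositionalEquality
  using (_≡_; refl; sym; trans; cong; cong₂; subst; subst₂; module ≡-Reasoning)
open import Relation.Nullary.Negation using (contradiction)

[k+1]*[n+1]C[k+1]≡[n+1]*nCk : ∀ n k → suc k ℕ.* (suc n C suc k) ≡ suc n ℕ.* (n C k)
[k+1]*[n+1]C[k+1]≡[n+1]*nCk n zero =
  trans (ℕ.+-identityʳ (suc n C 1)) (trans (nC1≡n (suc n)) (sym (ℕ.*-identityʳ (suc n))))
[k+1]*[n+1]C[k+1]≡[n+1]*nCk zero (suc k) = ℕ.*-zeroʳ (suc (suc k))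
[k+1]*[n+1]C[k+1]≡[n+1]*nCk (suc n) (suc k) = begin
    suc (suc k) ℕ.* (suc (suc n) C suc (suc k))
  ≡⟨ cong (suc (suc k) ℕ.*_) (sym (nCk+nC[k+1]≡[n+1]C[k+1] (suc n) (suc k))) ⟩
    suc (suc k) ℕ.* (a ℕ.+ b)
  ≡⟨ distrib (suc k) a b ⟩
    suc k ℕ.* a ℕ.+ a ℕ.+ suc (suc k) ℕ.* b
  ≡⟨ cong₂ (λ x y → x ℕ.+ a ℕ.+ y) ([k+1]*[n+1]C[k+1]≡[n+1]*nCk n k) ([k+1]*[n+1]C[k+1]≡[n+1]*nCk n (suc k)) ⟩
    suc n ℕ.* (n C k) ℕ.+ a ℕ.+ suc n ℕ.* (n C suc k)
  ≡⟨ collect (suc n) (n C k) (n C suc k) a ⟩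
    suc n ℕ.* (n C k ℕ.+ n C suc k) ℕ.+ a
  ≡⟨ cong (λ x → suc n ℕ.* x ℕ.+ a) (nCk+nC[k+1]≡[n+1]C[k+1] n k) ⟩
    suc n ℕ.* a ℕ.+ a
  ≡⟨ ℕ.+-comm (suc n ℕ.* a) a ⟩
    suc (suc n) ℕ.* a ∎
  where
  open ≡-Reasoning
  a = suc n C suc k
  b = suc n C suc (suc k)
  distrib : ∀ x a b → suc x ℕ.* (a ℕ.+ b) ≡ x ℕ.* a ℕ.+ a ℕ.+ suc x ℕ.* b
  distrib = ℕ-Solver.solve-∀
  collect : ∀ x c d a → x ℕ.* c ℕ.+ a ℕ.+ x ℕ.* d ≡ x ℕ.* (c ℕ.+ d) ℕ.+ a
  collect = ℕ-Solver.solve-∀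

[k+1]*nC[k+1]+[k+1]*nCk≡[n+1]*nCk : ∀ n k →
  suc k ℕ.* (n C suc k) ℕ.+ suc k ℕ.* (n C k) ≡ suc n ℕ.* (n C k)
[k+1]*nC[k+1]+[k+1]*nCk≡[n+1]*nCk n k = begin
  suc k ℕ.* (n C suc k) ℕ.+ suc k ℕ.* (n C k) ≡⟨ ℕ.+-comm (suc k ℕ.* (n C suc k)) _ ⟩
  suc k ℕ.* (n C k) ℕ.+ suc k ℕ.* (n C suc k) ≡⟨ ℕ.*-distribˡ-+ (suc k) (n C k) (n C suc k) ⟨
  suc k ℕ.* (n C k ℕ.+ n C suc k)             ≡⟨ cong (suc k ℕ.*_) (nCk+nC[k+1]≡[n+1]C[k+1] n k) ⟩
  suc k ℕ.* (suc n C suc k)                   ≡⟨ [k+1]*[n+1]C[k+1]≡[n+1]*nCk n k ⟩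
  suc n ℕ.* (n C k)                           ∎
  where open ≡-Reasoning

[2n+2]C[n+1]≡2*[2n+1]Cn : ∀ n → (2 ℕ.* suc n) C suc n ≡ 2 ℕ.* ((suc n ℕ.+ n) C n)
[2n+2]C[n+1]≡2*[2n+1]Cn n = ℕ.*-cancelˡ-≡ _ _ (suc n) (begin
    suc n ℕ.* ((2 ℕ.* suc n) C suc n)
  ≡⟨ cong (λ x → suc n ℕ.* (x C suc n)) (trans (cong (suc n ℕ.+_) (ℕ.+-identityʳ (suc n))) (ℕ.+-suc (suc n) n)) ⟩
    suc n ℕ.* (suc (suc n ℕ.+ n) C suc n)
  ≡⟨ [k+1]*[n+1]C[k+1]≡[n+1]*nCk (suc n ℕ.+ n) n ⟩
    suc (suc n ℕ.+ n) ℕ.* ((suc n ℕ.+ n) C n)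
  ≡⟨ cong (ℕ._* ((suc n ℕ.+ n) C n)) (sym (ℕ.+-suc (suc n) n)) ⟩
    (suc n ℕ.+ suc n) ℕ.* ((suc n ℕ.+ n) C n)
  ≡⟨ twice (suc n) ((suc n ℕ.+ n) C n) ⟩
    suc n ℕ.* (2 ℕ.* ((suc n ℕ.+ n) C n)) ∎)
  where
  open ≡-Reasoning
  twice : ∀ m x → (m ℕ.+ m) ℕ.* x ≡ m ℕ.* (2 ℕ.* x)
  twice = ℕ-Solver.solve-∀

double : ℕ → ℕ
double zero    = zero
double (suc m) = suc (suc (double m))

double≡m+m : ∀ m → double m ≡ m ℕ.+ m
double≡m+m zero    = refl
double≡m+m (suc m) = cong suc (trans (cong suc (double≡m+m m)) (sym (ℕ.+-suc m m)))

2∣double : ∀ m → 2 ℕ∣.∣ double m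
2∣double m = ℕ∣.divides m (trans (double≡m+m m) (trans (cong (m ℕ.+_) (sym (ℕ.+-identityʳ m))) (ℕ.*-comm 2 m)))

double-mono-≤ : ∀ {a b} → a ≤ b → double a ≤ double b
double-mono-≤ {a} {b} a≤b = subst₂ _≤_ (sym (double≡m+m a)) (sym (double≡m+m b)) (ℕ.+-mono-≤ a≤b a≤b)

m≤double[m] : ∀ m → m ≤ double m
m≤double[m] m = subst (m ≤_) (sym (double≡m+m m)) (ℕ.m≤m+n m m)

even-or-odd : ∀ k → (∃[ m ] k ≡ double m) ⊎ (∃[ m ] k ≡ suc (double m))
even-or-odd zero = inj₁ (0 , refl)
even-or-odd (suc k) with even-or-odd k
... | inj₁ (m , refl) = inj₂ (m , refl)
... | inj₂ (m , refl) = inj₁ (suc m , refl)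

7≤2m+1⇒3≤m : ∀ m → 7 ≤ suc (double m) → 3 ≤ m
7≤2m+1⇒3≤m 0 (s≤s ())
7≤2m+1⇒3≤m 1 (s≤s (s≤s (s≤s ())))
7≤2m+1⇒3≤m 2 (s≤s (s≤s (s≤s (s≤s (s≤s ())))))
7≤2m+1⇒3≤m (suc (suc (suc m))) _ = s≤s (s≤s (s≤s z≤n))

coprime-* : ∀ {m n o} → Coprime m n → Coprime m o → Coprime m (n ℕ.* o)
coprime-* m⊥n m⊥o (i∣m , i∣no) =
  m⊥o (i∣m , Coprimality.coprime-divisor (λ (j∣i , j∣n) → m⊥n (ℕ∣.∣-trans j∣i i∣m , j∣n)) i∣no)

coprime-^ : ∀ {m n} → Coprime m n → ∀ e → Coprime m (n ℕ.^ e)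
coprime-^ {m} m⊥n zero    = Coprimality.sym (Coprimality.1-coprimeTo m)
coprime-^     m⊥n (suc e) = coprime-* m⊥n (coprime-^ m⊥n e)

module IteratedOp (M : CommutativeMonoid 0ℓ 0ℓ) where
  open CommutativeMonoid M renaming (refl to ≈-refl; sym to ≈-sym; trans to ≈-trans)
  open import Algebra.Properties.CommutativeSemigroup commutativeSemigroup using (interchange)
  open import Relation.Binary.Reasoning.Setoid setoid

  -- ⨁ f N = f 1 ∙ f 2 ∙ ⋯ ∙ f N; the index 0 is never used.
  ⨁ : (ℕ → Carrier) → ℕ → Carrier
  ⨁ f zero    = ε
  ⨁ f (suc N) = ⨁ f N ∙ f (suc N)

  cong-on : ∀ {ℓ} {R : Rel Carrier ℓ} → Reflexive R → _∙_ Preserves₂ R ⟶ R ⟶ R →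
            ∀ {f g} N → (∀ k → 1 ≤ k → k ≤ N → R (f k) (g k)) → R (⨁ f N) (⨁ g N)
  cong-on R-refl ∙-R-cong zero    f≈g = R-refl
  cong-on {R = R} R-refl ∙-R-cong {f} {g} (suc N) f≈g =
    ∙-R-cong (cong-on {R = R} R-refl ∙-R-cong {f} {g} N (λ k 1≤k k≤N → f≈g k 1≤k (ℕ.m≤n⇒m≤1+n k≤N)))
             (f≈g (suc N) (s≤s z≤n) ℕ.≤-refl)

  pointwise : ∀ {f g} N → (∀ k → f k ≈ g k) → ⨁ f N ≈ ⨁ g N
  pointwise {f} {g} N f≈g = cong-on {R = _≈_} ≈-refl ∙-cong {f} {g} N (λ k _ _ → f≈g k)

  ⨁-ε : ∀ N → ⨁ (λ _ → ε) N ≈ ε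
  ⨁-ε zero    = ≈-refl
  ⨁-ε (suc N) = ≈-trans (identityʳ _) (⨁-ε N)

  distrib : ∀ f g N → ⨁ (λ k → f k ∙ g k) N ≈ ⨁ f N ∙ ⨁ g N
  distrib f g zero    = ≈-sym (identityˡ ε)
  distrib f g (suc N) = begin
    ⨁ (λ k → f k ∙ g k) N ∙ (f (suc N) ∙ g (suc N)) ≈⟨ ∙-congʳ (distrib f g N) ⟩
    (⨁ f N ∙ ⨁ g N) ∙ (f (suc N) ∙ g (suc N))      ≈⟨ interchange _ _ _ _ ⟩
    ⨁ f (suc N) ∙ ⨁ g (suc N)                      ∎

  unshift : ∀ f N → ⨁ f (suc N) ≈ f 1 ∙ ⨁ (λ k → f (suc k)) N
  unshift f zero    = ≈-trans (identityˡ (f 1)) (≈-sym (identityʳ (f 1)))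
  unshift f (suc N) = ≈-trans (∙-congʳ (unshift f N)) (assoc _ _ _)

  reverse : ∀ f N → ⨁ f N ≈ ⨁ (λ k → f (suc N ℕ.∸ k)) N
  reverse f zero    = ≈-refl
  reverse f (suc N) = begin
    ⨁ f N ∙ f (suc N)                                  ≈⟨ ∙-congʳ (reverse f N) ⟩
    ⨁ (λ k → f (suc N ℕ.∸ k)) N ∙ f (suc N)            ≈⟨ comm _ _ ⟩
    f (suc N) ∙ ⨁ (λ k → f (suc N ℕ.∸ k)) N            ≈⟨ unshift (λ k → f (suc (suc N) ℕ.∸ k)) N ⟨
    ⨁ (λ k → f (suc (suc N) ℕ.∸ k)) (suc N)            ∎

  split : ∀ f a b → ⨁ f (a ℕ.+ b) ≈ ⨁ f a ∙ ⨁ (λ k → f (a ℕ.+ k)) b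
  split f a zero    rewrite ℕ.+-identityʳ a = ≈-sym (identityʳ (⨁ f a))
  split f a (suc b) rewrite ℕ.+-suc a b     = ≈-trans (∙-congʳ (split f a b)) (assoc _ _ _)

  interleave : ∀ f m → ⨁ f (double m) ≈ ⨁ (λ k → f (double k)) m ∙ ⨁ (λ k → f (pred (double k))) m
  interleave f zero    = ≈-sym (identityˡ ε)
  interleave f (suc m) = begin
    (⨁ f (double m) ∙ f (suc (double m))) ∙ f (double (suc m))
      ≈⟨ ∙-congʳ (∙-congʳ (interleave f m)) ⟩
    ((⨁ (λ k → f (double k)) m ∙ ⨁ (λ k → f (pred (double k))) m) ∙ f (suc (double m))) ∙ f (double (suc m))
      ≈⟨ assoc _ _ _ ⟩
    (⨁ (λ k → f (double k)) m ∙ ⨁ (λ k → f (pred (double k))) m) ∙ (f (suc (double m)) ∙ f (double (suc m)))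
      ≈⟨ ∙-congˡ (comm _ _) ⟩
    (⨁ (λ k → f (double k)) m ∙ ⨁ (λ k → f (pred (double k))) m) ∙ (f (double (suc m)) ∙ f (suc (double m)))
      ≈⟨ interchange _ _ _ _ ⟩
    ⨁ (λ k → f (double k)) (suc m) ∙ ⨁ (λ k → f (pred (double k))) (suc m) ∎

module ModularArithmetic where

  open import Data.Integer using (ℤ; +_; 0ℤ; 1ℤ; -_; _+_; _-_; _*_)
  import Data.Integer.Properties as ℤ
  open import Data.Integer.Divisibility.Signed
    using (_∣_; divides; ∣m∣n⇒∣m+n; ∣m⇒∣-m; ∣m⇒∣m*n; ∣n⇒∣m*n; ∣-trans; ∣-refl)
  open import Data.Integer.Tactic.RingSolver using (solve-∀)
  open import Data.List using (map; upTo; _++_; [_])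
  open import Data.List.Properties using (upTo-∷ʳ; map-++)
  open import Data.Nat.ListAction using (sum)
  open import Data.Nat.ListAction.Properties using (sum-++)

  infix 4 _≡_mod_
  record _≡_mod_ (a b M : ℤ) : Set where
    constructor mod-divides
    field divides-difference : M ∣ a - b
  open _≡_mod_ public

  module _ {M : ℤ} where

    ≡-mod-refl : ∀ {a} → a ≡ a mod M
    ≡-mod-refl {a} = mod-divides (divides 0ℤ (trans (ℤ.+-inverseʳ a) (sym (ℤ.*-zeroˡ M))))

    ≡⇒≡-mod : ∀ {a b} → a ≡ b → a ≡ b mod M
    ≡⇒≡-mod refl = ≡-mod-refl

    ≡-mod-sym : ∀ {a b} → a ≡ b mod M → b ≡ a mod M
    ≡-mod-sym {a} {b} (mod-divides d) = mod-divides (subst (M ∣_) (negate a b) (∣m⇒∣-m d))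
      where negate : ∀ a b → - (a - b) ≡ b - a
            negate = solve-∀

    ≡-mod-trans : ∀ {a b c} → a ≡ b mod M → b ≡ c mod M → a ≡ c mod M
    ≡-mod-trans {a} {b} {c} (mod-divides d) (mod-divides e) =
      mod-divides (subst (M ∣_) (telescope a b c) (∣m∣n⇒∣m+n d e))
      where telescope : ∀ a b c → (a - b) + (b - c) ≡ a - c
            telescope = solve-∀

    +-cong-mod : ∀ {a b c d} → a ≡ b mod M → c ≡ d mod M → a + c ≡ b + d mod M
    +-cong-mod {a} {b} {c} {d} (mod-divides x) (mod-divides y) =
      mod-divides (subst (M ∣_) (regroup a b c d) (∣m∣n⇒∣m+n x y))
      where regroup : ∀ a b c d → (a - b) + (c - d) ≡ (a + c) - (b + d)
            regroup = solve-∀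

    neg-cong-mod : ∀ {a b} → a ≡ b mod M → - a ≡ - b mod M
    neg-cong-mod {a} {b} (mod-divides x) = mod-divides (subst (M ∣_) (negate a b) (∣m⇒∣-m x))
      where negate : ∀ a b → - (a - b) ≡ - a - - b
            negate = solve-∀

    *-cong-mod : ∀ {a b c d} → a ≡ b mod M → c ≡ d mod M → a * c ≡ b * d mod M
    *-cong-mod {a} {b} {c} {d} (mod-divides x) (mod-divides y) =
      mod-divides (subst (M ∣_) (regroup a b c d) (∣m∣n⇒∣m+n (∣m⇒∣m*n c x) (∣n⇒∣m*n b y)))
      where regroup : ∀ a b c d → (a - b) * c + b * (c - d) ≡ a * c - b * d
            regroup = solve-∀

    *-congˡ-mod : ∀ c {a b} → a ≡ b mod M → c * a ≡ c * b mod M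
    *-congˡ-mod c = *-cong-mod (≡-mod-refl {c})

    +-multiple≡-mod : ∀ a c → a + M * c ≡ a mod M
    +-multiple≡-mod a c = mod-divides (divides c (cancel a M c))
      where cancel : ∀ a M c → (a + M * c) - a ≡ c * M
            cancel = solve-∀

    ≡-mod-setoid : Setoid 0ℓ 0ℓ
    ≡-mod-setoid = record
      { Carrier       = ℤ
      ; _≈_           = _≡_mod M
      ; isEquivalence = record { refl = ≡-mod-refl ; sym = ≡-mod-sym ; trans = ≡-mod-trans }
      }

    module ≡-mod-Reasoning where
      open import Relation.Binary.Reasoning.Setoid ≡-mod-setoid public

    inverse-unique-mod : ∀ a {x y} → a * x ≡ 1ℤ mod M → a * y ≡ 1ℤ mod M → x ≡ y mod M
    inverse-unique-mod a {x} {y} ax≡1 ay≡1 = begin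
      x            ≡⟨ ℤ.*-identityʳ x ⟨
      x * 1ℤ       ≈⟨ *-congˡ-mod x (≡-mod-sym ay≡1) ⟩
      x * (a * y)  ≡⟨ swap x a y ⟩
      (a * x) * y  ≈⟨ *-cong-mod ax≡1 (≡-mod-refl {y}) ⟩
      1ℤ * y       ≡⟨ ℤ.*-identityˡ y ⟩
      y            ∎
      where
      open ≡-mod-Reasoning
      swap : ∀ x a y → x * (a * y) ≡ (a * x) * y
      swap = solve-∀

    cancel-unit-mod : ∀ c w {x y} → c * w ≡ 1ℤ mod M → c * x ≡ c * y mod M → x ≡ y mod M
    cancel-unit-mod c w {x} {y} cw≡1 cx≡cy = begin
      x            ≡⟨ ℤ.*-identityˡ x ⟨
      1ℤ * x       ≈⟨ *-cong-mod (≡-mod-sym cw≡1) (≡-mod-refl {x}) ⟩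
      (c * w) * x  ≡⟨ swap c w x ⟩
      w * (c * x)  ≈⟨ *-congˡ-mod w cx≡cy ⟩
      w * (c * y)  ≡⟨ swap c w y ⟨
      (c * w) * y  ≈⟨ *-cong-mod cw≡1 (≡-mod-refl {y}) ⟩
      1ℤ * y       ≡⟨ ℤ.*-identityˡ y ⟩
      y            ∎
      where
      open ≡-mod-Reasoning
      swap : ∀ c w x → (c * w) * x ≡ w * (c * x)
      swap = solve-∀

  *-scale-mod : ∀ c {M a b} → a ≡ b mod M → c * a ≡ c * b mod c * M
  *-scale-mod c {M} {a} {b} (mod-divides (divides q eq)) = mod-divides (divides q (begin
    c * a - c * b  ≡⟨ factor c a b ⟩
    c * (a - b)    ≡⟨ cong (c *_) eq ⟩
    c * (q * M)    ≡⟨ swap c q M ⟩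
    q * (c * M)    ∎))
    where
    open ≡-Reasoning
    factor : ∀ c a b → c * a - c * b ≡ c * (a - b)
    factor = solve-∀
    swap : ∀ c q M → c * (q * M) ≡ q * (c * M)
    swap = solve-∀

  ≡-mod-∣ : ∀ {N M a b} → N ∣ M → a ≡ b mod M → a ≡ b mod N
  ≡-mod-∣ N∣M (mod-divides M∣a-b) = mod-divides (∣-trans N∣M M∣a-b)

  *-inverse-product : ∀ {M a b x y} → a * x ≡ 1ℤ mod M → b * y ≡ 1ℤ mod M → (a * b) * (x * y) ≡ 1ℤ mod M
  *-inverse-product {M} {a} {b} {x} {y} ax≡1 by≡1 = begin
    (a * b) * (x * y)  ≡⟨ regroup a b x y ⟩
    (a * x) * (b * y)  ≈⟨ *-cong-mod ax≡1 by≡1 ⟩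
    1ℤ * 1ℤ            ≡⟨⟩
    1ℤ                 ∎
    where
    open ≡-mod-Reasoning
    regroup : ∀ a b x y → (a * b) * (x * y) ≡ (a * x) * (b * y)
    regroup = solve-∀

  fixed-by-unit : ∀ {M} c d {x} → x ≡ c * x mod M → d * c ≡ 1ℤ mod M → (d - 1ℤ) * x ≡ 0ℤ mod M
  fixed-by-unit c d {x} x≡cx dc≡1 = begin
    (d - 1ℤ) * x   ≡⟨ expand d x ⟩
    d * x - x      ≈⟨ +-cong-mod (*-congˡ-mod d x≡cx) (≡-mod-refl {a = - x}) ⟩
    d * (c * x) - x ≡⟨ reassoc d c x ⟩
    (d * c) * x - x ≈⟨ +-cong-mod (*-cong-mod dc≡1 (≡-mod-refl {a = x})) (≡-mod-refl {a = - x}) ⟩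
    1ℤ * x - x     ≡⟨ cancel x ⟩
    0ℤ             ∎
    where
    open ≡-mod-Reasoning
    expand : ∀ d x → (d - 1ℤ) * x ≡ d * x - x
    expand = solve-∀
    reassoc : ∀ d c x → d * (c * x) - x ≡ (d * c) * x - x
    reassoc = solve-∀
    cancel : ∀ x → 1ℤ * x - x ≡ 0ℤ
    cancel = solve-∀

  inverse-reflection-cube : ∀ M K {v w} → (M - K) * v ≡ 1ℤ mod M * M → K * w ≡ 1ℤ mod M * M →
    v * v * v + w * w * w ≡ - + 3 * M * (w * w * w * w) mod M * M
  inverse-reflection-cube M K {v} {w} [M-K]v≡1 Kw≡1 = begin
    v * v * v + w * w * w  ≈⟨ +-cong-mod (*-cong-mod (*-cong-mod v≡ v≡) v≡) (≡-mod-refl {a = w * w * w}) ⟩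
    y * y * y + w * w * w  ≡⟨ cube-expansion M w ⟩
    - + 3 * M * (w * w * w * w) + M * M * (- + 3 * (w * w * w * w * w) - M * (w * w * w * w * w * w))
                           ≈⟨ +-multiple≡-mod _ _ ⟩
    - + 3 * M * (w * w * w * w) ∎
    where
    open ≡-mod-Reasoning
    y = - w - M * (w * w)
    M∣M² : M ∣ M * M
    M∣M² = ∣m⇒∣m*n M ∣-refl
    M-K≡-K : M - K ≡ - K mod M
    M-K≡-K = mod-divides (divides 1ℤ (difference M K))
      where difference : ∀ M K → (M - K) - - K ≡ 1ℤ * M
            difference = solve-∀
    v≡-w : v ≡ - w mod M
    v≡-w = inverse-unique-mod (- K)
      (≡-mod-trans (*-cong-mod (≡-mod-sym M-K≡-K) (≡-mod-refl {a = v})) (≡-mod-∣ M∣M² [M-K]v≡1))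
      (≡-mod-trans (≡⇒≡-mod (neg*neg K w)) (≡-mod-∣ M∣M² Kw≡1))
      where neg*neg : ∀ K w → - K * - w ≡ K * w
            neg*neg = solve-∀
    -- 1/(M − K) ≡ −1/K − M/K² modulo M², using 1/(M − K) ≡ −1/K modulo M.
    v≡ : v ≡ y mod M * M
    v≡ = begin
      v                                ≡⟨ ℤ.*-identityʳ v ⟨
      v * 1ℤ                           ≈⟨ *-congˡ-mod v (≡-mod-sym Kw≡1) ⟩
      v * (K * w)                      ≡⟨ split-K v w M K ⟩
      w * (M * v) - w * ((M - K) * v)  ≈⟨ +-cong-mod (*-congˡ-mod w (*-scale-mod M v≡-w)) (neg-cong-mod (*-congˡ-mod w [M-K]v≡1)) ⟩
      w * (M * - w) - w * 1ℤ           ≡⟨ collect M w ⟩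
      y                                ∎
      where
      split-K : ∀ v w M K → v * (K * w) ≡ w * (M * v) - w * ((M - K) * v)
      split-K = solve-∀
      collect : ∀ M w → w * (M * - w) - w * 1ℤ ≡ - w - M * (w * w)
      collect = solve-∀
    cube-expansion : ∀ M w → (- w - M * (w * w)) * (- w - M * (w * w)) * (- w - M * (w * w)) + w * w * w
      ≡ - + 3 * M * (w * w * w * w) + M * M * (- + 3 * (w * w * w * w * w) - M * (w * w * w * w * w * w))
    cube-expansion = solve-∀

  private
    inverseFromBézout : ∀ {k M} → Bézout.Lemma k M → ℤ
    inverseFromBézout (Bézout.result _ _ (Bézout.+- x _ _)) = + x
    inverseFromBézout (Bézout.result _ _ (Bézout.-+ x _ _)) = - + x

    inverseFromBézout-correct : ∀ {k M} → Coprime k M → (b : Bézout.Lemma k M) →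
                                + k * inverseFromBézout b ≡ 1ℤ mod + M
    inverseFromBézout-correct {k} {M} k⊥M (Bézout.result d g identity)
      with GCD.unique g (coprime⇒GCD≡1 k⊥M)
    ... | refl with identity
    ...   | Bézout.+- x y eq = mod-divides (divides (+ y) (begin
            + k * + x - 1ℤ        ≡⟨ cong (_- 1ℤ) (ℤ.*-comm (+ k) (+ x)) ⟩
            + x * + k - 1ℤ        ≡⟨ cong (_- 1ℤ) (ℤ.pos-* x k) ⟨
            + (x ℕ.* k) - 1ℤ      ≡⟨ cong (λ z → + z - 1ℤ) eq ⟨
            + (1 ℕ.+ y ℕ.* M) - 1ℤ ≡⟨ cong (_- 1ℤ) (trans (ℤ.pos-+ 1 (y ℕ.* M)) (cong (λ z → 1ℤ + z) (ℤ.pos-* y M))) ⟩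
            1ℤ + + y * + M - 1ℤ   ≡⟨ cancel (+ y * + M) ⟩
            + y * + M             ∎))
            where
            open ≡-Reasoning
            cancel : ∀ z → 1ℤ + z - 1ℤ ≡ z
            cancel = solve-∀
    ...   | Bézout.-+ x y eq = mod-divides (divides (- + y) (begin
            + k * - + x - 1ℤ         ≡⟨ rearrange (+ k) (+ x) ⟩
            - (1ℤ + + x * + k)       ≡⟨ cong (λ z → - (1ℤ + z)) (ℤ.pos-* x k) ⟨
            - (+ (1 ℕ.+ x ℕ.* k))    ≡⟨ cong (λ z → - + z) eq ⟩
            - + (y ℕ.* M)            ≡⟨ cong -_ (ℤ.pos-* y M) ⟩
            - (+ y * + M)            ≡⟨ ℤ.neg-distribˡ-* (+ y) (+ M) ⟩
            - + y * + M              ∎))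
            where
            open ≡-Reasoning
            rearrange : ∀ k x → k * - x - 1ℤ ≡ - (1ℤ + x * k)
            rearrange = solve-∀

  modInverse : ℕ → ℕ → ℤ
  modInverse k M = inverseFromBézout (Bézout.lemma k M)

  *-modInverse : ∀ {k M} → Coprime k M → + k * modInverse k M ≡ 1ℤ mod + M
  *-modInverse {k} {M} k⊥M = inverseFromBézout-correct k⊥M (Bézout.lemma k M)

  module Sum     = IteratedOp ℤ.+-0-commutativeMonoid
  module Product = IteratedOp ℤ.*-1-commutativeMonoid

  ∑ ∏ : (ℕ → ℤ) → ℕ → ℤ
  ∑ = Sum.⨁
  ∏ = Product.⨁

  ∑-*-distribˡ : ∀ c f N → ∑ (λ k → c * f k) N ≡ c * ∑ f N
  ∑-*-distribˡ c f zero    = sym (ℤ.*-zeroʳ c)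
  ∑-*-distribˡ c f (suc N) =
    trans (cong (_+ c * f (suc N)) (∑-*-distribˡ c f N)) (sym (ℤ.*-distribˡ-+ c (∑ f N) (f (suc N))))

  ∑-cong-mod : ∀ {M f g} N → (∀ k → 1 ≤ k → k ≤ N → f k ≡ g k mod M) → ∑ f N ≡ ∑ g N mod M
  ∑-cong-mod {M} {f} {g} = Sum.cong-on {R = _≡_mod M} ≡-mod-refl +-cong-mod {f} {g}

  ∏-cong-mod : ∀ {M f g} N → (∀ k → 1 ≤ k → k ≤ N → f k ≡ g k mod M) → ∏ f N ≡ ∏ g N mod M
  ∏-cong-mod {M} {f} {g} = Product.cong-on {R = _≡_mod M} ≡-mod-refl *-cong-mod {f} {g}

  -- e₂ a N = ∑_{1 ≤ j < k ≤ N} a j * a k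
  e₂ : (ℕ → ℤ) → ℕ → ℤ
  e₂ a N = ∑ (λ k → a k * ∑ a (pred k)) N

  2*e₂≡∑²-∑sq : ∀ a N → + 2 * e₂ a N ≡ ∑ a N * ∑ a N - ∑ (λ k → a k * a k) N
  2*e₂≡∑²-∑sq a zero    = refl
  2*e₂≡∑²-∑sq a (suc N) = begin
    + 2 * (e₂ a N + x * s)                  ≡⟨ ℤ.*-distribˡ-+ (+ 2) (e₂ a N) (x * s) ⟩
    + 2 * e₂ a N + + 2 * (x * s)            ≡⟨ cong (_+ + 2 * (x * s)) (2*e₂≡∑²-∑sq a N) ⟩
    (s * s - q) + + 2 * (x * s)             ≡⟨ square-step s q x ⟩
    (s + x) * (s + x) - (q + x * x)         ∎
    where
    open ≡-Reasoning
    x = a (suc N)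
    s = ∑ a N
    q = ∑ (λ k → a k * a k) N
    square-step : ∀ s q x → (s * s - q) + + 2 * (x * s) ≡ (s + x) * (s + x) - (q + x * x)
    square-step = solve-∀

  ∏[1-Ma]≡1-M∑a+M²e₂ : ∀ M a N →
    ∏ (λ k → 1ℤ - M * a k) N ≡ 1ℤ - M * ∑ a N + M * M * e₂ a N mod M * M * M
  ∏[1-Ma]≡1-M∑a+M²e₂ M a zero    = ≡⇒≡-mod (empty M)
    where
    empty : ∀ M → 1ℤ ≡ 1ℤ - M * 0ℤ + M * M * 0ℤ
    empty = solve-∀
  ∏[1-Ma]≡1-M∑a+M²e₂ M a (suc N) = begin
    ∏ (λ k → 1ℤ - M * a k) N * (1ℤ - M * x)       ≈⟨ *-cong-mod (∏[1-Ma]≡1-M∑a+M²e₂ M a N) (≡-mod-refl {a = 1ℤ - M * x}) ⟩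
    (1ℤ - M * s + M * M * e) * (1ℤ - M * x)       ≡⟨ expand M s e x ⟩
    (1ℤ - M * (s + x) + M * M * (e + x * s)) + M * M * M * (- (e * x)) ≈⟨ +-multiple≡-mod _ (- (e * x)) ⟩
    1ℤ - M * (s + x) + M * M * (e + x * s)        ∎
    where
    open ≡-mod-Reasoning
    x = a (suc N)
    s = ∑ a N
    e = e₂ a N
    expand : ∀ M s e x → (1ℤ - M * s + M * M * e) * (1ℤ - M * x)
           ≡ (1ℤ - M * (s + x) + M * M * (e + x * s)) + M * M * M * (- (e * x))
    expand = solve-∀

  ∏-neg-one-double : ∀ m → ∏ (λ _ → - 1ℤ) (double m) ≡ 1ℤ
  ∏-neg-one-double zero    = refl
  ∏-neg-one-double (suc m) = cong (λ x → x * - 1ℤ * - 1ℤ) (∏-neg-one-double m)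

  +sum-upTo : ∀ (f : ℕ → ℕ) N → + sum (map f (upTo (suc N))) ≡ + f 0 + ∑ (λ k → + f k) N
  +sum-upTo f zero    = refl
  +sum-upTo f (suc N) = begin
    + sum (map f (upTo (suc (suc N))))               ≡⟨ cong (λ xs → + sum (map f xs)) (upTo-∷ʳ (suc N)) ⟨
    + sum (map f (upTo (suc N) ++ [ suc N ]))        ≡⟨ cong (λ xs → + sum xs) (map-++ f (upTo (suc N)) [ suc N ]) ⟩
    + sum (map f (upTo (suc N)) ++ [ f (suc N) ])    ≡⟨ cong +_ (sum-++ (map f (upTo (suc N))) [ f (suc N) ]) ⟩
    + (sum (map f (upTo (suc N))) ℕ.+ (f (suc N) ℕ.+ 0))
                                                     ≡⟨ cong (λ x → + (sum (map f (upTo (suc N))) ℕ.+ x)) (ℕ.+-identityʳ (f (suc N))) ⟩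
    + (sum (map f (upTo (suc N))) ℕ.+ f (suc N))     ≡⟨ ℤ.pos-+ (sum (map f (upTo (suc N)))) (f (suc N)) ⟩
    + sum (map f (upTo (suc N))) + + f (suc N)       ≡⟨ cong (_+ + f (suc N)) (+sum-upTo f N) ⟩
    (+ f 0 + ∑ (λ k → + f k) N) + + f (suc N)        ≡⟨ ℤ.+-assoc (+ f 0) (∑ (λ k → + f k) N) (+ f (suc N)) ⟩
    + f 0 + ∑ (λ k → + f k) (suc N)                  ∎
    where open ≡-Reasoning

module OddPrime (m : ℕ) (p-prime : Prime (suc (double m))) (3≤m : 3 ≤ m) where

  open ModularArithmetic
  open import Defs using (apery)
  open import Data.Integer using (ℤ; +_; 0ℤ; 1ℤ; -_; _+_; _-_; _*_)
  import Data.Integer.Properties as ℤ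
  open import Data.Integer.Divisibility.Signed using (_∣_; divides; ∣m⇒∣m*n; ∣n⇒∣m*n; ∣-refl; ∣-reflexive)
  open import Data.Integer.Tactic.RingSolver using (solve-∀)

  p n : ℕ
  p = suc (double m)
  n = double m

  -- Powers of p and inverses modulo p⁵

  P P² P³ P⁴ P⁵ : ℤ
  P  = + p
  P² = P * P
  P³ = P² * P
  P⁴ = P² * P²
  P⁵ = P⁴ * P

  P∣P⁵ : P ∣ P⁵
  P∣P⁵ = ∣n⇒∣m*n P⁴ ∣-refl

  P²∣P⁵ : P² ∣ P⁵
  P²∣P⁵ = ∣m⇒∣m*n P (∣n⇒∣m*n P² ∣-refl)

  P⁵∣P²*P³ : P⁵ ∣ P² * P³
  P⁵∣P²*P³ = ∣-reflexive (regroup P)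
    where regroup : ∀ P → P * P * (P * P) * P ≡ P * P * (P * P * P)
          regroup = solve-∀

  P⁵∣P³*P² : P⁵ ∣ P³ * P²
  P⁵∣P³*P² = ∣-reflexive (regroup P)
    where regroup : ∀ P → P * P * (P * P) * P ≡ P * P * P * (P * P)
          regroup = solve-∀

  P³∣P⁶ : P³ ∣ P² * P² * P²
  P³∣P⁶ = divides P³ (regroup P)
    where regroup : ∀ P → P * P * (P * P) * (P * P) ≡ P * P * P * (P * P * P)
          regroup = solve-∀

  P⁵∣P⁶ : P⁵ ∣ P² * P² * P²
  P⁵∣P⁶ = divides P (regroup P)
    where regroup : ∀ P → P * P * (P * P) * (P * P) ≡ P * (P * P * (P * P) * P)
          regroup = solve-∀

  p⁵≡P⁵ : + (p ℕ.^ 5) ≡ P⁵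
  p⁵≡P⁵ = begin
    + (p ℕ.* (p ℕ.* (p ℕ.* (p ℕ.* (p ℕ.* 1)))))  ≡⟨ cong (λ x → + (p ℕ.* (p ℕ.* (p ℕ.* (p ℕ.* x))))) (ℕ.*-identityʳ p) ⟩
    + (p ℕ.* (p ℕ.* (p ℕ.* (p ℕ.* p))))          ≡⟨ ℤ.pos-* p (p ℕ.* (p ℕ.* (p ℕ.* p))) ⟩
    P * + (p ℕ.* (p ℕ.* (p ℕ.* p)))              ≡⟨ cong (P *_) (ℤ.pos-* p (p ℕ.* (p ℕ.* p))) ⟩
    P * (P * + (p ℕ.* (p ℕ.* p)))                ≡⟨ cong (λ x → P * (P * x)) (trans (ℤ.pos-* p (p ℕ.* p)) (cong (P *_) (ℤ.pos-* p p))) ⟩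
    P * (P * (P * (P * P)))                      ≡⟨ regroup P ⟩
    P⁵                                           ∎
    where
    open ≡-Reasoning
    regroup : ∀ P → P * (P * (P * (P * P))) ≡ P * P * (P * P) * P
    regroup = solve-∀

  n≥6 : 6 ≤ n
  n≥6 = subst (6 ≤_) (sym (double≡m+m m)) (ℕ.+-mono-≤ 3≤m 3≤m)

  inverse : ℕ → ℤ
  inverse k = modInverse k (p ℕ.^ 5)

  *-inverse : ∀ k → 1 ≤ k → k < p → + k * inverse k ≡ 1ℤ mod P⁵
  *-inverse (suc k) _ k<p = subst (λ M → + suc k * inverse (suc k) ≡ 1ℤ mod M) p⁵≡P⁵
    (*-modInverse (coprime-^ (Coprimality.sym (prime⇒coprime p-prime k<p)) 5))

  *-inverse-mod : ∀ {M} → M ∣ P⁵ → ∀ k → 1 ≤ k → k < p → + k * inverse k ≡ 1ℤ mod M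
  *-inverse-mod M∣P⁵ k 1≤k k<p = ≡-mod-∣ M∣P⁵ (*-inverse k 1≤k k<p)

  small<p : ∀ {k} → k ≤ 6 → k < p
  small<p k≤6 = s≤s (ℕ.≤-trans k≤6 n≥6)

  half : ℤ
  half = inverse 2

  *-half : ∀ {M} → M ∣ P⁵ → + 2 * half ≡ 1ℤ mod M
  *-half M∣P⁵ = *-inverse-mod M∣P⁵ 2 (s≤s z≤n) (small<p (s≤s (s≤s z≤n)))

  inverse-double : ∀ {k} → 1 ≤ k → k ≤ m → inverse (double k) ≡ half * inverse k mod P
  inverse-double {k} 1≤k k≤m = inverse-unique-mod (+ double k)
    (*-inverse-mod P∣P⁵ (double k) (ℕ.≤-trans 1≤k (m≤double[m] k)) (s≤s (double-mono-≤ k≤m)))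
    (subst (λ a → a * (half * inverse k) ≡ 1ℤ mod P) (sym +double≡2*)
      (*-inverse-product {a = + 2} {+ k} {half} {inverse k} (*-half P∣P⁵) (*-inverse-mod P∣P⁵ k 1≤k k<p)))
    where
    k<p : k < p
    k<p = s≤s (ℕ.≤-trans k≤m (m≤double[m] m))
    +double≡2* : + double k ≡ + 2 * + k
    +double≡2* = trans (cong +_ (trans (double≡m+m k) (cong (k ℕ.+_) (sym (ℕ.+-identityʳ k))))) (ℤ.pos-* 2 k)

  inverse-double-pred : ∀ {k} → 1 ≤ k → k ≤ m → inverse (pred (double k)) ≡ half * inverse (m ℕ.+ k) mod P
  inverse-double-pred {suc j} _ k≤m = inverse-unique-mod (+ suc (double j))
    (*-inverse-mod P∣P⁵ (suc (double j)) (s≤s z≤n) (s≤s (ℕ.≤-trans (ℕ.n≤1+n _) (double-mono-≤ k≤m))))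
    (≡-mod-trans (*-cong-mod 2k-1≡2[m+k] (≡-mod-refl {a = half * inverse (m ℕ.+ suc j)}))
      (*-inverse-product {a = + 2} {+ (m ℕ.+ suc j)} {half} {inverse (m ℕ.+ suc j)} (*-half P∣P⁵)
        (*-inverse-mod P∣P⁵ (m ℕ.+ suc j) (subst (1 ≤_) (sym (ℕ.+-suc m j)) (s≤s z≤n))
          (s≤s (subst (m ℕ.+ suc j ≤_) (sym (double≡m+m m)) (ℕ.+-monoʳ-≤ m k≤m))))))
    where
    sum≡ : suc (double j) ℕ.+ p ≡ 2 ℕ.* (m ℕ.+ suc j)
    sum≡ rewrite double≡m+m j | double≡m+m m = arith m j
      where
      arith : ∀ m j → suc (j ℕ.+ j) ℕ.+ suc (m ℕ.+ m) ≡ 2 ℕ.* (m ℕ.+ suc j)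
      arith = ℕ-Solver.solve-∀
    2k-1≡2[m+k] : + suc (double j) ≡ + 2 * + (m ℕ.+ suc j) mod P
    2k-1≡2[m+k] = begin
      + suc (double j)                  ≈⟨ +-multiple≡-mod (+ suc (double j)) 1ℤ ⟨
      + suc (double j) + P * 1ℤ         ≡⟨ cong (λ x → + suc (double j) + x) (ℤ.*-identityʳ P) ⟩
      + suc (double j) + P              ≡⟨ ℤ.pos-+ (suc (double j)) p ⟨
      + (suc (double j) ℕ.+ p)          ≡⟨ cong +_ sum≡ ⟩
      + (2 ℕ.* (m ℕ.+ suc j))           ≡⟨ ℤ.pos-* 2 (m ℕ.+ suc j) ⟩
      + 2 * + (m ℕ.+ suc j)             ∎
      where open ≡-mod-Reasoning

  -- Power sums of inverses

  -- Every unit modulo p is 2j or 2j − 1 ≡ 2(m + j) for some 1 ≤ j ≤ m.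
  ∑-halving : ∀ (g : ℤ → ℤ) → (∀ {x y} → x ≡ y mod P → g x ≡ g y mod P) →
              ∑ (λ k → g (inverse k)) n ≡ ∑ (λ k → g (half * inverse k)) n mod P
  ∑-halving g g-cong = begin
    ∑ f n                                                      ≡⟨ Sum.interleave f m ⟩
    ∑ (λ k → f (double k)) m + ∑ (λ k → f (pred (double k))) m
      ≈⟨ +-cong-mod (∑-cong-mod m (λ k 1≤k k≤m → g-cong (inverse-double 1≤k k≤m)))
                    (∑-cong-mod m (λ k 1≤k k≤m → g-cong (inverse-double-pred 1≤k k≤m))) ⟩
    ∑ f½ m + ∑ (λ k → f½ (m ℕ.+ k)) m                           ≡⟨ Sum.split f½ m m ⟨
    ∑ f½ (m ℕ.+ m)                                              ≡⟨ cong (∑ f½) (double≡m+m m) ⟨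
    ∑ f½ n                                                      ∎
    where
    open ≡-mod-Reasoning
    f f½ : ℕ → ℤ
    f  k = g (inverse k)
    f½ k = g (half * inverse k)

  *-three : + 3 * inverse 3 ≡ 1ℤ mod P
  *-three = *-inverse-mod P∣P⁵ 3 (s≤s z≤n) (small<p (s≤s (s≤s (s≤s z≤n))))

  *-five : + 5 * inverse 5 ≡ 1ℤ mod P
  *-five = *-inverse-mod P∣P⁵ 5 (s≤s z≤n) (small<p (s≤s (s≤s (s≤s (s≤s (s≤s z≤n))))))

  H₂ H₃ H₄ : ℤ
  H₂ = ∑ (λ k → inverse k * inverse k) n
  H₃ = ∑ (λ k → inverse k * inverse k * inverse k) n
  H₄ = ∑ (λ k → inverse k * inverse k * inverse k * inverse k) n

  H₂≡0 : H₂ ≡ 0ℤ mod P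
  H₂≡0 = cancel-unit-mod (+ 3) (inverse 3) *-three (fixed-by-unit (half * half) (+ 4) H₂≡¼H₂ 4*¼≡1)
    where
    open ≡-mod-Reasoning
    H₂≡¼H₂ : H₂ ≡ half * half * H₂ mod P
    H₂≡¼H₂ = begin
      H₂                                                  ≈⟨ ∑-halving (λ x → x * x) (λ x≡y → *-cong-mod x≡y x≡y) ⟩
      ∑ (λ k → (half * inverse k) * (half * inverse k)) n ≡⟨ Sum.pointwise n (λ k → square-* half (inverse k)) ⟩
      ∑ (λ k → half * half * (inverse k * inverse k)) n   ≡⟨ ∑-*-distribˡ (half * half) (λ k → inverse k * inverse k) n ⟩
      half * half * H₂                                    ∎
      where
      square-* : ∀ h x → (h * x) * (h * x) ≡ h * h * (x * x)
      square-* = solve-∀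
    4*¼≡1 : + 4 * (half * half) ≡ 1ℤ mod P
    4*¼≡1 = *-inverse-product {a = + 2} {+ 2} {half} {half} (*-half P∣P⁵) (*-half P∣P⁵)

  H₄≡0 : H₄ ≡ 0ℤ mod P
  H₄≡0 = cancel-unit-mod (+ 5) (inverse 5) *-five (cancel-unit-mod (+ 3) (inverse 3) *-three
           -- 16 − 1 = 3 · 5
           (≡-mod-trans (≡⇒≡-mod (sym (ℤ.*-assoc (+ 3) (+ 5) H₄))) (fixed-by-unit (¼ * ¼) (+ 16) H₄≡¹⁄₁₆H₄ 16*¹⁄₁₆≡1)))
    where
    open ≡-mod-Reasoning
    ¼ : ℤ
    ¼ = half * half
    H₄≡¹⁄₁₆H₄ : H₄ ≡ ¼ * ¼ * H₄ mod P
    H₄≡¹⁄₁₆H₄ = begin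
      H₄  ≈⟨ ∑-halving (λ x → x * x * x * x) (λ x≡y → *-cong-mod (*-cong-mod (*-cong-mod x≡y x≡y) x≡y) x≡y) ⟩
      ∑ (λ k → (half * inverse k) * (half * inverse k) * (half * inverse k) * (half * inverse k)) n
        ≡⟨ Sum.pointwise n (λ k → fourth-* half (inverse k)) ⟩
      ∑ (λ k → ¼ * ¼ * (inverse k * inverse k * inverse k * inverse k)) n
        ≡⟨ ∑-*-distribˡ (¼ * ¼) (λ k → inverse k * inverse k * inverse k * inverse k) n ⟩
      ¼ * ¼ * H₄ ∎
      where
      fourth-* : ∀ h x → (h * x) * (h * x) * (h * x) * (h * x) ≡ h * h * (h * h) * (x * x * x * x)
      fourth-* = solve-∀
    16*¹⁄₁₆≡1 : + 16 * (¼ * ¼) ≡ 1ℤ mod P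
    16*¹⁄₁₆≡1 = *-inverse-product {a = + 4} {+ 4} {¼} {¼} 4*¼≡1 4*¼≡1
      where
      4*¼≡1 : + 4 * ¼ ≡ 1ℤ mod P
      4*¼≡1 = *-inverse-product {a = + 2} {+ 2} {half} {half} (*-half P∣P⁵) (*-half P∣P⁵)

  +[p∸k]≡P-k : ∀ {k} → k ≤ p → + (p ∸ k) ≡ P - + k
  +[p∸k]≡P-k {k} k≤p = begin
    + (p ∸ k)               ≡⟨ add-sub (+ (p ∸ k)) (+ k) ⟩
    + (p ∸ k) + + k - + k   ≡⟨ cong (_- + k) (ℤ.pos-+ (p ∸ k) k) ⟨
    + (p ∸ k ℕ.+ k) - + k   ≡⟨ cong (λ x → + x - + k) (ℕ.m∸n+n≡m k≤p) ⟩
    P - + k                 ∎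
    where
    open ≡-Reasoning
    add-sub : ∀ a b → a ≡ a + b - b
    add-sub = solve-∀

  H₃≡0 : H₃ ≡ 0ℤ mod P²
  H₃≡0 = cancel-unit-mod (+ 2) half (*-half P²∣P⁵) (begin
    + 2 * H₃                                 ≡⟨ twice H₃ ⟩
    ∑ cube n + H₃                            ≡⟨ cong (_+ H₃) (Sum.reverse cube n) ⟩
    ∑ (λ k → cube (p ∸ k)) n + H₃            ≡⟨ Sum.distrib (λ k → cube (p ∸ k)) cube n ⟨
    ∑ (λ k → cube (p ∸ k) + cube k) n        ≈⟨ ∑-cong-mod n reflection ⟩
    ∑ (λ k → - + 3 * P * fourth k) n         ≡⟨ ∑-*-distribˡ (- + 3 * P) fourth n ⟩
    - + 3 * P * H₄                           ≡⟨ ℤ.*-assoc (- + 3) P H₄ ⟩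
    - + 3 * (P * H₄)                         ≈⟨ *-congˡ-mod (- + 3) (*-scale-mod P H₄≡0) ⟩
    - + 3 * (P * 0ℤ)                         ≡⟨ cong (- + 3 *_) (ℤ.*-zeroʳ P) ⟩
    0ℤ                                       ∎)
    where
    open ≡-mod-Reasoning
    cube fourth : ℕ → ℤ
    cube   k = inverse k * inverse k * inverse k
    fourth k = inverse k * inverse k * inverse k * inverse k
    twice : ∀ x → + 2 * x ≡ x + x
    twice = solve-∀
    reflection : ∀ k → 1 ≤ k → k ≤ n → cube (p ∸ k) + cube k ≡ - + 3 * P * fourth k mod P²
    reflection k 1≤k k≤n = inverse-reflection-cube P (+ k)
      (subst (λ a → a * inverse (p ∸ k) ≡ 1ℤ mod P²) (+[p∸k]≡P-k (ℕ.m≤n⇒m≤1+n k≤n))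
        (*-inverse-mod P²∣P⁵ (p ∸ k) (ℕ.m<n⇒0<n∸m (s≤s k≤n)) (ℕ.∸-monoʳ-< 1≤k (ℕ.m≤n⇒m≤1+n k≤n))))
      (*-inverse-mod P²∣P⁵ k 1≤k (s≤s k≤n))

  E : ℤ
  E = e₂ (λ k → inverse k * inverse k) n

  E≡0 : E ≡ 0ℤ mod P
  E≡0 = cancel-unit-mod (+ 2) half (*-half P∣P⁵) (begin
    + 2 * E          ≡⟨ 2*e₂≡∑²-∑sq (λ k → inverse k * inverse k) n ⟩
    H₂ * H₂ - ∑ (λ k → inverse k * inverse k * (inverse k * inverse k)) n
                     ≡⟨ cong (λ x → H₂ * H₂ - x) (Sum.pointwise n (λ k → reassoc (inverse k))) ⟩
    H₂ * H₂ - H₄     ≈⟨ +-cong-mod (*-cong-mod H₂≡0 H₂≡0) (neg-cong-mod H₄≡0) ⟩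
    0ℤ               ∎)
    where
    open ≡-mod-Reasoning
    reassoc : ∀ x → x * x * (x * x) ≡ x * x * x * x
    reassoc = solve-∀

  -- The central binomial coefficient

  [p+k+1]C[k+1]-recurrence : ∀ k →
    + suc k * + ((p ℕ.+ suc k) C suc k) ≡ (P + + suc k) * + ((p ℕ.+ k) C k)
  [p+k+1]C[k+1]-recurrence k = begin
    + suc k * + ((p ℕ.+ suc k) C suc k)    ≡⟨ cong (λ x → + suc k * + (x C suc k)) (ℕ.+-suc p k) ⟩
    + suc k * + (suc (p ℕ.+ k) C suc k)    ≡⟨ ℤ.pos-* (suc k) (suc (p ℕ.+ k) C suc k) ⟨
    + (suc k ℕ.* (suc (p ℕ.+ k) C suc k))  ≡⟨ cong +_ ([k+1]*[n+1]C[k+1]≡[n+1]*nCk (p ℕ.+ k) k) ⟩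
    + (suc (p ℕ.+ k) ℕ.* ((p ℕ.+ k) C k))  ≡⟨ ℤ.pos-* (suc (p ℕ.+ k)) ((p ℕ.+ k) C k) ⟩
    + suc (p ℕ.+ k) * + ((p ℕ.+ k) C k)    ≡⟨ cong (λ x → x * + ((p ℕ.+ k) C k)) (trans (cong +_ (sym (ℕ.+-suc p k))) (ℤ.pos-+ p (suc k))) ⟩
    (P + + suc k) * + ((p ℕ.+ k) C k)      ∎
    where open ≡-Reasoning

  [p+N]CN≡∏[1+P/k] : ∀ N → N ≤ n → + ((p ℕ.+ N) C N) ≡ ∏ (λ k → 1ℤ + P * inverse k) N mod P⁵
  [p+N]CN≡∏[1+P/k] zero    _    = ≡-mod-refl
  [p+N]CN≡∏[1+P/k] (suc j) j<n = begin
    B (suc j)                      ≡⟨ ℤ.*-identityˡ (B (suc j)) ⟨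
    1ℤ * B (suc j)                 ≈⟨ *-cong-mod (≡-mod-sym Kw≡1) (≡-mod-refl {a = B (suc j)}) ⟩
    (K * w) * B (suc j)            ≡⟨ reassoc K w (B (suc j)) ⟩
    w * (K * B (suc j))            ≡⟨ cong (w *_) ([p+k+1]C[k+1]-recurrence j) ⟩
    w * ((P + K) * B j)            ≡⟨ distrib w P K (B j) ⟩
    (P * w + K * w) * B j          ≈⟨ *-cong-mod (+-cong-mod (≡-mod-refl {a = P * w}) Kw≡1) ([p+N]CN≡∏[1+P/k] j (ℕ.<⇒≤ j<n)) ⟩
    (P * w + 1ℤ) * ∏ f j           ≡⟨ ℤ.*-comm (P * w + 1ℤ) (∏ f j) ⟩
    ∏ f j * (P * w + 1ℤ)           ≡⟨ cong (∏ f j *_) (ℤ.+-comm (P * w) 1ℤ) ⟩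
    ∏ f (suc j)                    ∎
    where
    open ≡-mod-Reasoning
    B : ℕ → ℤ
    B k = + ((p ℕ.+ k) C k)
    f : ℕ → ℤ
    f k = 1ℤ + P * inverse k
    K = + suc j
    w = inverse (suc j)
    Kw≡1 : K * w ≡ 1ℤ mod P⁵
    Kw≡1 = *-inverse (suc j) (s≤s z≤n) (s≤s j<n)
    reassoc : ∀ K w b → (K * w) * b ≡ w * (K * b)
    reassoc = solve-∀
    distrib : ∀ w P K b → w * ((P + K) * b) ≡ (P * w + K * w) * b
    distrib = solve-∀

  ∏[k-P]≡∏k : ∏ (λ k → + k - P) n ≡ ∏ +_ n
  ∏[k-P]≡∏k = begin
    ∏ (λ k → + k - P) n                  ≡⟨ Product.reverse (λ k → + k - P) n ⟩
    ∏ (λ k → + (p ∸ k) - P) n            ≡⟨ Product.cong-on {R = _≡_} refl (cong₂ _*_) n reflect ⟩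
    ∏ (λ k → - 1ℤ * + k) n               ≡⟨ Product.distrib (λ _ → - 1ℤ) +_ n ⟩
    ∏ (λ _ → - 1ℤ) n * ∏ +_ n            ≡⟨ cong (_* ∏ +_ n) (∏-neg-one-double m) ⟩
    1ℤ * ∏ +_ n                          ≡⟨ ℤ.*-identityˡ (∏ +_ n) ⟩
    ∏ +_ n                               ∎
    where
    open ≡-Reasoning
    negate : ∀ P K → (P - K) - P ≡ - 1ℤ * K
    negate = solve-∀
    reflect : ∀ k → 1 ≤ k → k ≤ n → + (p ∸ k) - P ≡ - 1ℤ * + k
    reflect k _ k≤n = trans (cong (_- P) (+[p∸k]≡P-k (ℕ.m≤n⇒m≤1+n k≤n))) (negate P (+ k))

  ∏[1-P/k]≡1 : ∏ (λ k → 1ℤ - P * inverse k) n ≡ 1ℤ mod P⁵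
  ∏[1-P/k]≡1 = begin
    ∏ (λ k → 1ℤ - P * inverse k) n        ≈⟨ ∏-cong-mod n 1-P/k≡[k-P]/k ⟩
    ∏ (λ k → (+ k - P) * inverse k) n     ≡⟨ Product.distrib (λ k → + k - P) inverse n ⟩
    ∏ (λ k → + k - P) n * ∏ inverse n     ≡⟨ cong (_* ∏ inverse n) ∏[k-P]≡∏k ⟩
    ∏ +_ n * ∏ inverse n                  ≡⟨ Product.distrib +_ inverse n ⟨
    ∏ (λ k → + k * inverse k) n           ≈⟨ ∏-cong-mod n (λ k 1≤k k≤n → *-inverse k 1≤k (s≤s k≤n)) ⟩
    ∏ (λ _ → 1ℤ) n                        ≡⟨ Product.⨁-ε n ⟩
    1ℤ                                    ∎
    where
    open ≡-mod-Reasoning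
    factor : ∀ K P w → K * w - P * w ≡ (K - P) * w
    factor = solve-∀
    1-P/k≡[k-P]/k : ∀ k → 1 ≤ k → k ≤ n → 1ℤ - P * inverse k ≡ (+ k - P) * inverse k mod P⁵
    1-P/k≡[k-P]/k k 1≤k k≤n =
      ≡-mod-trans (+-cong-mod (≡-mod-sym (*-inverse k 1≤k (s≤s k≤n))) (≡-mod-refl {a = - (P * inverse k)}))
                  (≡⇒≡-mod (factor (+ k) P (inverse k)))

  [p+n]Cn≡1-P²H₂+P⁴E : + ((p ℕ.+ n) C n) ≡ 1ℤ - P² * H₂ + P⁴ * E mod P⁵
  [p+n]Cn≡1-P²H₂+P⁴E = begin
    + ((p ℕ.+ n) C n)                   ≈⟨ [p+N]CN≡∏[1+P/k] n ℕ.≤-refl ⟩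
    ∏ f n                               ≡⟨ ℤ.*-identityʳ (∏ f n) ⟨
    ∏ f n * 1ℤ                          ≈⟨ *-congˡ-mod (∏ f n) (≡-mod-sym ∏[1-P/k]≡1) ⟩
    ∏ f n * ∏ g n                       ≡⟨ Product.distrib f g n ⟨
    ∏ (λ k → f k * g k) n               ≡⟨ Product.pointwise n (λ k → difference-of-squares P (inverse k)) ⟩
    ∏ (λ k → 1ℤ - P² * (inverse k * inverse k)) n
                                        ≈⟨ ≡-mod-∣ P⁵∣P⁶ (∏[1-Ma]≡1-M∑a+M²e₂ P² (λ k → inverse k * inverse k) n) ⟩
    1ℤ - P² * H₂ + P⁴ * E               ∎
    where
    open ≡-mod-Reasoning
    f g : ℕ → ℤ
    f k = 1ℤ + P * inverse k
    g k = 1ℤ - P * inverse k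
    difference-of-squares : ∀ P w → (1ℤ + P * w) * (1ℤ - P * w) ≡ 1ℤ - P * P * (w * w)
    difference-of-squares = solve-∀

  -- The Apéry summands

  A : ℕ → ℤ
  A k = + (n C k) * + ((n ℕ.+ k) C k)

  +apery≡1+∑A² : + apery n ≡ 1ℤ + ∑ (λ k → A k * A k) n
  +apery≡1+∑A² = trans (+sum-upTo _ n) (cong (λ x → 1ℤ + x) (Sum.pointwise n +term≡A²))
    where
    square-square : ∀ a b → (a ℕ.* (a ℕ.* 1)) ℕ.* (b ℕ.* (b ℕ.* 1)) ≡ (a ℕ.* b) ℕ.* (a ℕ.* b)
    square-square = ℕ-Solver.solve-∀
    +term≡A² : ∀ k → + ((n C k) ℕ.^ 2 ℕ.* ((n ℕ.+ k) C k) ℕ.^ 2) ≡ A k * A k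
    +term≡A² k = begin
      + ((n C k) ℕ.^ 2 ℕ.* ((n ℕ.+ k) C k) ℕ.^ 2)   ≡⟨ cong +_ (square-square (n C k) ((n ℕ.+ k) C k)) ⟩
      + (a ℕ.* b ℕ.* (a ℕ.* b))                     ≡⟨ ℤ.pos-* (a ℕ.* b) (a ℕ.* b) ⟩
      + (a ℕ.* b) * + (a ℕ.* b)                     ≡⟨ cong₂ _*_ (ℤ.pos-* a b) (ℤ.pos-* a b) ⟩
      A k * A k                                     ∎
      where
      open ≡-Reasoning
      a = n C k
      b = (n ℕ.+ k) C k

  [k+1]*nC[k+1]≡[P-k-1]*nCk : ∀ k → + suc k * + (n C suc k) ≡ (P - + suc k) * + (n C k)
  [k+1]*nC[k+1]≡[P-k-1]*nCk k = move (begin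
    K * a' + K * a                                    ≡⟨ cong₂ _+_ (ℤ.pos-* (suc k) (n C suc k)) (ℤ.pos-* (suc k) (n C k)) ⟨
    + (suc k ℕ.* (n C suc k)) + + (suc k ℕ.* (n C k)) ≡⟨ ℤ.pos-+ (suc k ℕ.* (n C suc k)) (suc k ℕ.* (n C k)) ⟨
    + (suc k ℕ.* (n C suc k) ℕ.+ suc k ℕ.* (n C k))   ≡⟨ cong +_ ([k+1]*nC[k+1]+[k+1]*nCk≡[n+1]*nCk n k) ⟩
    + (p ℕ.* (n C k))                                 ≡⟨ ℤ.pos-* p (n C k) ⟩
    P * a                                             ∎)
    where
    open ≡-Reasoning
    K a a' : ℤ
    K  = + suc k
    a  = + (n C k)
    a' = + (n C suc k)
    move : K * a' + K * a ≡ P * a → K * a' ≡ (P - K) * a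
    move eq = trans (add-sub (K * a') (K * a)) (trans (cong (_- K * a) eq) (factor P K a))
      where
      add-sub : ∀ x y → x ≡ x + y - y
      add-sub = solve-∀
      factor : ∀ c K b → c * b - K * b ≡ (c - K) * b
      factor = solve-∀

  [k+1]*[n+k+1]C[k+1]≡[P+k]*[n+k]Ck : ∀ k → + suc k * + ((n ℕ.+ suc k) C suc k) ≡ (P + + k) * + ((n ℕ.+ k) C k)
  [k+1]*[n+k+1]C[k+1]≡[P+k]*[n+k]Ck k = begin
    + suc k * + ((n ℕ.+ suc k) C suc k)          ≡⟨ cong (λ x → + suc k * + (x C suc k)) (ℕ.+-suc n k) ⟩
    + suc k * + (suc (n ℕ.+ k) C suc k)          ≡⟨ ℤ.pos-* (suc k) (suc (n ℕ.+ k) C suc k) ⟨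
    + (suc k ℕ.* (suc (n ℕ.+ k) C suc k))        ≡⟨ cong +_ ([k+1]*[n+1]C[k+1]≡[n+1]*nCk (n ℕ.+ k) k) ⟩
    + ((p ℕ.+ k) ℕ.* ((n ℕ.+ k) C k))            ≡⟨ ℤ.pos-* (p ℕ.+ k) ((n ℕ.+ k) C k) ⟩
    + (p ℕ.+ k) * + ((n ℕ.+ k) C k)              ≡⟨ cong (_* + ((n ℕ.+ k) C k)) (ℤ.pos-+ p k) ⟩
    (P + + k) * + ((n ℕ.+ k) C k)                ∎
    where open ≡-Reasoning

  A-recurrence : ∀ k → + suc k * + suc k * A (suc k) ≡ (P - + suc k) * (P + + k) * A k
  A-recurrence k = begin
    K * K * (a' * b')                ≡⟨ regroup K a' b' ⟩
    (K * a') * (K * b')              ≡⟨ cong₂ _*_ ([k+1]*nC[k+1]≡[P-k-1]*nCk k) ([k+1]*[n+k+1]C[k+1]≡[P+k]*[n+k]Ck k) ⟩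
    ((P - K) * a) * ((P + + k) * b)  ≡⟨ regroup' (P - K) (P + + k) a b ⟩
    (P - K) * (P + + k) * (a * b)    ∎
    where
    open ≡-Reasoning
    K a b a' b' : ℤ
    K  = + suc k
    a  = + (n C k)
    b  = + ((n ℕ.+ k) C k)
    a' = + (n C suc k)
    b' = + ((n ℕ.+ suc k) C suc k)
    regroup : ∀ K a b → K * K * (a * b) ≡ (K * a) * (K * b)
    regroup = solve-∀
    regroup' : ∀ x y a b → (x * a) * (y * b) ≡ x * y * (a * b)
    regroup' = solve-∀

  z : ℕ → ℤ
  z k = inverse k * (1ℤ - P * inverse k)

  G : ℕ → ℤ
  G N = ∏ (λ k → 1ℤ - P² * (inverse k * inverse k)) N

  c : ℕ → ℤ
  c k = inverse (suc k) * inverse (suc k) * ((P - + suc k) * (P + + k))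

  A[k+1]≡cA[k] : ∀ k → k < n → A (suc k) ≡ c k * A k mod P⁵
  A[k+1]≡cA[k] k k<n = begin
    A (suc k)                               ≡⟨ ℤ.*-identityˡ (A (suc k)) ⟨
    1ℤ * A (suc k)                          ≈⟨ *-cong-mod (≡-mod-sym (*-cong-mod Kw≡1 Kw≡1)) (≡-mod-refl {a = A (suc k)}) ⟩
    (K * w) * (K * w) * A (suc k)           ≡⟨ regroup K w (A (suc k)) ⟩
    w * w * (K * K * A (suc k))             ≡⟨ cong (λ x → w * w * x) (A-recurrence k) ⟩
    w * w * ((P - K) * (P + + k) * A k)     ≡⟨ ℤ.*-assoc (w * w) ((P - K) * (P + + k)) (A k) ⟨
    c k * A k                               ∎
    where
    open ≡-mod-Reasoning
    K = + suc k
    w = inverse (suc k)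
    Kw≡1 : K * w ≡ 1ℤ mod P⁵
    Kw≡1 = *-inverse (suc k) (s≤s z≤n) (s≤s k<n)
    regroup : ∀ K w a → (K * w) * (K * w) * a ≡ w * w * (K * K * a)
    regroup = solve-∀

  c*z≡-z*[1-P²/k²] : ∀ k → 1 ≤ k → k < n →
    c k * z k ≡ - z (suc k) * (1ℤ - P² * (inverse k * inverse k)) mod P⁵
  c*z≡-z*[1-P²/k²] k 1≤k k<n = begin
    c k * z k
      ≡⟨ regroup w' P K' (+ k) w ⟩
    (P * (w' * w') - w' * (K' * w')) * ((P * w + + k * w) * (1ℤ - P * w))
      ≈⟨ *-cong-mod (+-cong-mod (≡-mod-refl {a = P * (w' * w')}) (neg-cong-mod (*-congˡ-mod w' K'w'≡1)))
                    (*-cong-mod (+-cong-mod (≡-mod-refl {a = P * w}) kw≡1) (≡-mod-refl {a = 1ℤ - P * w})) ⟩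
    (P * (w' * w') - w' * 1ℤ) * ((P * w + 1ℤ) * (1ℤ - P * w))
      ≡⟨ collect P w' w ⟩
    - z (suc k) * (1ℤ - P² * (w * w)) ∎
    where
    open ≡-mod-Reasoning
    K' = + suc k
    w' = inverse (suc k)
    w  = inverse k
    K'w'≡1 : K' * w' ≡ 1ℤ mod P⁵
    K'w'≡1 = *-inverse (suc k) (s≤s z≤n) (s≤s k<n)
    kw≡1 : + k * w ≡ 1ℤ mod P⁵
    kw≡1 = *-inverse k 1≤k (s≤s (ℕ.<⇒≤ k<n))
    regroup : ∀ w' P K' k w → w' * w' * ((P - K') * (P + k)) * (w * (1ℤ - P * w))
            ≡ (P * (w' * w') - w' * (K' * w')) * ((P * w + k * w) * (1ℤ - P * w))
    regroup = solve-∀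
    collect : ∀ P w' w → (P * (w' * w') - w' * 1ℤ) * ((P * w + 1ℤ) * (1ℤ - P * w))
            ≡ - (w' * (1ℤ - P * w')) * (1ℤ - P * P * (w * w))
    collect = solve-∀

  A₁≡[P-1]P : A 1 ≡ (P - 1ℤ) * P
  A₁≡[P-1]P = begin
    + (n C 1) * + ((n ℕ.+ 1) C 1)   ≡⟨ cong₂ (λ a b → + a * + b) (nC1≡n n) (trans (nC1≡n (n ℕ.+ 1)) (ℕ.+-comm n 1)) ⟩
    + n * P                         ≡⟨ cong (_* P) (add-sub (+ n)) ⟩
    (1ℤ + + n - 1ℤ) * P             ≡⟨ cong (λ x → (x - 1ℤ) * P) (ℤ.pos-+ 1 n) ⟨
    (P - 1ℤ) * P                    ∎
    where
    open ≡-Reasoning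
    add-sub : ∀ x → x ≡ 1ℤ + x - 1ℤ
    add-sub = solve-∀

  A²≡P²z²G² : ∀ k → 1 ≤ k → k ≤ n → A k * A k ≡ P² * (z k * z k) * (G (pred k) * G (pred k)) mod P⁵
  A²≡P²z²G² (suc zero) _ _ = begin
    A 1 * A 1                              ≡⟨ cong (λ x → x * x) A₁≡[P-1]P ⟩
    (P - 1ℤ) * P * ((P - 1ℤ) * P)          ≡⟨ square P ⟩
    P² * ((1ℤ - P) * (1ℤ - P)) * (1ℤ * 1ℤ) ≈⟨ *-cong-mod (*-congˡ-mod P² (*-cong-mod z₁≡1-P z₁≡1-P)) (≡-mod-refl {a = 1ℤ}) ⟨
    P² * (z 1 * z 1) * (1ℤ * 1ℤ)           ∎
    where
    open ≡-mod-Reasoning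
    w₁≡1 : inverse 1 ≡ 1ℤ mod P⁵
    w₁≡1 = ≡-mod-trans (≡⇒≡-mod (sym (ℤ.*-identityˡ (inverse 1)))) (*-inverse 1 (s≤s z≤n) (small<p (s≤s z≤n)))
    z₁≡1-P : z 1 ≡ 1ℤ - P mod P⁵
    z₁≡1-P = ≡-mod-trans (*-cong-mod w₁≡1 (+-cong-mod (≡-mod-refl {a = 1ℤ}) (neg-cong-mod (*-congˡ-mod P w₁≡1))))
                         (≡⇒≡-mod (simplify P))
      where simplify : ∀ P → 1ℤ * (1ℤ - P * 1ℤ) ≡ 1ℤ - P
            simplify = solve-∀
    square : ∀ P → (P - 1ℤ) * P * ((P - 1ℤ) * P) ≡ P * P * ((1ℤ - P) * (1ℤ - P)) * (1ℤ * 1ℤ)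
    square = solve-∀
  A²≡P²z²G² (suc j@(suc k)) _ j<n = begin
    A (suc j) * A (suc j)                            ≈⟨ *-cong-mod step step ⟩
    (c j * A j) * (c j * A j)                        ≡⟨ regroup (c j) (A j) ⟩
    (c j * c j) * (A j * A j)                        ≈⟨ *-congˡ-mod (c j * c j) (A²≡P²z²G² j (s≤s z≤n) (ℕ.<⇒≤ j<n)) ⟩
    (c j * c j) * (P² * (z j * z j) * (G k * G k))   ≡⟨ regroup' (c j) P² (z j) (G k * G k) ⟩
    P² * ((c j * z j) * (c j * z j)) * (G k * G k)   ≈⟨ *-cong-mod (*-congˡ-mod P² (*-cong-mod cz cz)) (≡-mod-refl {a = G k * G k}) ⟩
    P² * ((- z' * g) * (- z' * g)) * (G k * G k)     ≡⟨ regroup'' P² z' g (G k) ⟩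
    P² * (z' * z') * ((G k * g) * (G k * g))         ∎
    where
    open ≡-mod-Reasoning
    z' = z (suc j)
    g  = 1ℤ - P² * (inverse j * inverse j)
    step : A (suc j) ≡ c j * A j mod P⁵
    step = A[k+1]≡cA[k] j j<n
    cz : c j * z j ≡ - z' * g mod P⁵
    cz = c*z≡-z*[1-P²/k²] j (s≤s z≤n) j<n
    regroup : ∀ c a → (c * a) * (c * a) ≡ (c * c) * (a * a)
    regroup = solve-∀
    regroup' : ∀ c Q y h → (c * c) * (Q * (y * y) * h) ≡ Q * ((c * y) * (c * y)) * h
    regroup' = solve-∀
    regroup'' : ∀ Q y g h → Q * ((- y * g) * (- y * g)) * (h * h) ≡ Q * (y * y) * ((h * g) * (h * g))
    regroup'' = solve-∀

  S : ℕ → ℤ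
  S N = ∑ (λ k → inverse k * inverse k) N

  G≡1-P²S : ∀ N → G N ≡ 1ℤ - P² * S N mod P³
  G≡1-P²S N = begin
    G N                                                      ≈⟨ ≡-mod-∣ P³∣P⁶ (∏[1-Ma]≡1-M∑a+M²e₂ P² (λ k → inverse k * inverse k) N) ⟩
    1ℤ - P² * S N + P² * P² * e₂ (λ k → inverse k * inverse k) N ≡⟨ cong (λ x → 1ℤ - P² * S N + x) (regroup P (e₂ (λ k → inverse k * inverse k) N)) ⟩
    1ℤ - P² * S N + P³ * (P * e₂ (λ k → inverse k * inverse k) N) ≈⟨ +-multiple≡-mod _ _ ⟩
    1ℤ - P² * S N                                            ∎
    where
    open ≡-mod-Reasoning
    regroup : ∀ P e → P * P * (P * P) * e ≡ P * P * P * (P * e)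
    regroup = solve-∀

  A²-expansion : ∀ k → 1 ≤ k → k ≤ n →
    A k * A k ≡ P² * (inverse k * inverse k) + (- + 2 * (P³ * (inverse k * inverse k * inverse k))
                + P⁴ * (inverse k * inverse k * inverse k * inverse k)
                + - + 2 * (P⁴ * (inverse k * inverse k * S (pred k)))) mod P⁵
  A²-expansion k 1≤k k≤n = begin
    A k * A k                                    ≈⟨ A²≡P²z²G² k 1≤k k≤n ⟩
    P² * (z k * z k) * (G (pred k) * G (pred k)) ≡⟨ ℤ.*-assoc P² (z k * z k) _ ⟩
    P² * (z k * z k * (G (pred k) * G (pred k)))
      ≈⟨ ≡-mod-∣ P⁵∣P²*P³ (*-scale-mod P² (*-congˡ-mod (z k * z k) (*-cong-mod G≡ G≡))) ⟩
    P² * (z k * z k * ((1ℤ - P² * s) * (1ℤ - P² * s)))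
      ≡⟨ expand P (z k) s ⟩
    P² * (z k * z k) + - + 2 * (P⁴ * (z k * z k * s)) + P⁵ * (P * (z k * z k) * (s * s))
      ≈⟨ +-multiple≡-mod _ _ ⟩
    P² * (z k * z k) + - + 2 * (P⁴ * (z k * z k * s))
      ≈⟨ +-cong-mod (≡-mod-refl {a = P² * (z k * z k)}) (*-congˡ-mod (- + 2) (*-scale-mod P⁴ (*-cong-mod (*-cong-mod z≡w z≡w) (≡-mod-refl {a = s})))) ⟩
    P² * (z k * z k) + - + 2 * (P⁴ * (w * w * s))
      ≡⟨ expand' P w (- + 2 * (P⁴ * (w * w * s))) ⟩
    P² * (w * w) + (- + 2 * (P³ * (w * w * w)) + P⁴ * (w * w * w * w) + - + 2 * (P⁴ * (w * w * s))) ∎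
    where
    open ≡-mod-Reasoning
    w = inverse k
    s = S (pred k)
    G≡ : G (pred k) ≡ 1ℤ - P² * s mod P³
    G≡ = G≡1-P²S (pred k)
    z≡w : z k ≡ w mod P
    z≡w = ≡-mod-trans (≡⇒≡-mod (distrib P w)) (+-multiple≡-mod w (- (w * w)))
      where distrib : ∀ P w → w * (1ℤ - P * w) ≡ w + P * - (w * w)
            distrib = solve-∀
    expand : ∀ P y s → P * P * (y * y * ((1ℤ - P * P * s) * (1ℤ - P * P * s)))
           ≡ P * P * (y * y) + - + 2 * (P * P * (P * P) * (y * y * s)) + P * P * (P * P) * P * (P * (y * y) * (s * s))
    expand = solve-∀
    expand' : ∀ P w x → P * P * ((w * (1ℤ - P * w)) * (w * (1ℤ - P * w))) + x
            ≡ P * P * (w * w) + (- + 2 * (P * P * P * (w * w * w)) + P * P * (P * P) * (w * w * w * w) + x)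
    expand' = solve-∀

  P⁴*≡0 : ∀ {x} → x ≡ 0ℤ mod P → P⁴ * x ≡ 0ℤ mod P⁵
  P⁴*≡0 x≡0 = ≡-mod-trans (*-scale-mod P⁴ x≡0) (≡⇒≡-mod (ℤ.*-zeroʳ P⁴))

  P³*H₃≡0 : P³ * H₃ ≡ 0ℤ mod P⁵
  P³*H₃≡0 = ≡-mod-∣ P⁵∣P³*P² (≡-mod-trans (*-scale-mod P³ H₃≡0) (≡⇒≡-mod (ℤ.*-zeroʳ P³)))

  ∑A²≡P²H₂ : ∑ (λ k → A k * A k) n ≡ P² * H₂ mod P⁵
  ∑A²≡P²H₂ = begin
    ∑ (λ k → A k * A k) n                 ≈⟨ ∑-cong-mod n A²-expansion ⟩
    ∑ (λ k → P² * sq k + rest k) n        ≡⟨ Sum.distrib (λ k → P² * sq k) rest n ⟩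
    ∑ (λ k → P² * sq k) n + ∑ rest n      ≡⟨ cong₂ _+_ (∑-*-distribˡ P² sq n) ∑rest≡ ⟩
    P² * H₂ + (- + 2 * (P³ * H₃) + P⁴ * H₄ + - + 2 * (P⁴ * E))
      ≈⟨ +-cong-mod (≡-mod-refl {a = P² * H₂})
           (+-cong-mod (+-cong-mod (*-congˡ-mod (- + 2) P³*H₃≡0) (P⁴*≡0 H₄≡0)) (*-congˡ-mod (- + 2) (P⁴*≡0 E≡0))) ⟩
    P² * H₂ + 0ℤ                          ≡⟨ ℤ.+-identityʳ (P² * H₂) ⟩
    P² * H₂                               ∎
    where
    open ≡-mod-Reasoning
    sq cube fourth r₁ r₂ r₃ rest : ℕ → ℤ
    sq     k = inverse k * inverse k
    cube   k = inverse k * inverse k * inverse k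
    fourth k = inverse k * inverse k * inverse k * inverse k
    r₁ k = - + 2 * (P³ * cube k)
    r₂ k = P⁴ * fourth k
    r₃ k = - + 2 * (P⁴ * (sq k * S (pred k)))
    rest k = r₁ k + r₂ k + r₃ k
    ∑-scale₂ : ∀ a b f → ∑ (λ k → a * (b * f k)) n ≡ a * (b * ∑ f n)
    ∑-scale₂ a b f = trans (∑-*-distribˡ a (λ k → b * f k) n) (cong (a *_) (∑-*-distribˡ b f n))
    ∑rest≡ : ∑ rest n ≡ - + 2 * (P³ * H₃) + P⁴ * H₄ + - + 2 * (P⁴ * E)
    ∑rest≡ = ≡.begin
      ∑ rest n                              ≡.≡⟨ Sum.distrib (λ k → r₁ k + r₂ k) r₃ n ⟩
      ∑ (λ k → r₁ k + r₂ k) n + ∑ r₃ n      ≡.≡⟨ cong (_+ ∑ r₃ n) (Sum.distrib r₁ r₂ n) ⟩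
      ∑ r₁ n + ∑ r₂ n + ∑ r₃ n              ≡.≡⟨ cong₂ _+_ (cong₂ _+_ (∑-scale₂ (- + 2) P³ cube) (∑-*-distribˡ P⁴ fourth n))
                                                              (∑-scale₂ (- + 2) P⁴ (λ k → sq k * S (pred k))) ⟩
      - + 2 * (P³ * H₃) + P⁴ * H₄ + - + 2 * (P⁴ * E) ≡.∎
      where module ≡ = ≡-Reasoning

  +apery≡1+P²H₂ : + apery n ≡ 1ℤ + P² * H₂ mod P⁵
  +apery≡1+P²H₂ = ≡-mod-trans (≡⇒≡-mod +apery≡1+∑A²) (+-cong-mod (≡-mod-refl {a = 1ℤ}) ∑A²≡P²H₂)

  +[p+n]Cn≡1-P²H₂ : + ((p ℕ.+ n) C n) ≡ 1ℤ - P² * H₂ mod P⁵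
  +[p+n]Cn≡1-P²H₂ = ≡-mod-trans [p+n]Cn≡1-P²H₂+P⁴E
    (≡-mod-trans (+-cong-mod (≡-mod-refl {a = 1ℤ - P² * H₂}) (P⁴*≡0 E≡0)) (≡⇒≡-mod (ℤ.+-identityʳ (1ℤ - P² * H₂))))

  [2p]Cp*apery≡2 : + (((2 ℕ.* p) C p) ℕ.* apery n) ≡ + 2 mod P⁵
  [2p]Cp*apery≡2 = begin
    + (((2 ℕ.* p) C p) ℕ.* apery n)                ≡⟨ ℤ.pos-* ((2 ℕ.* p) C p) (apery n) ⟩
    + ((2 ℕ.* p) C p) * + apery n                ≡⟨ cong (_* + apery n) +[2p]Cp≡2*B ⟩
    + 2 * + ((p ℕ.+ n) C n) * + apery n
      ≈⟨ *-cong-mod (*-congˡ-mod (+ 2) +[p+n]Cn≡1-P²H₂) +apery≡1+P²H₂ ⟩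
    + 2 * (1ℤ - P² * H₂) * (1ℤ + P² * H₂)        ≡⟨ difference-of-squares P H₂ ⟩
    + 2 - + 2 * (P⁴ * H₂ * H₂)
      ≈⟨ +-cong-mod (≡-mod-refl {a = + 2}) (neg-cong-mod (*-congˡ-mod (+ 2) (*-cong-mod (P⁴*≡0 H₂≡0) (≡-mod-refl {a = H₂})))) ⟩
    + 2                                          ∎
    where
    open ≡-mod-Reasoning
    +[2p]Cp≡2*B : + ((2 ℕ.* p) C p) ≡ + 2 * + ((p ℕ.+ n) C n)
    +[2p]Cp≡2*B = trans (cong +_ ([2n+2]C[n+1]≡2*[2n+1]Cn n)) (ℤ.pos-* 2 ((p ℕ.+ n) C n))
    difference-of-squares : ∀ P h → + 2 * (1ℤ - P * P * h) * (1ℤ + P * P * h) ≡ + 2 - + 2 * (P * P * (P * P) * h * h)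
    difference-of-squares = solve-∀

  p⁵∣[2p]Cp*apery-2 : + (p ℕ.^ 5) ∣ + (((2 ℕ.* p) C p) ℕ.* apery n) - + 2
  p⁵∣[2p]Cp*apery-2 = subst (_∣ + (((2 ℕ.* p) C p) ℕ.* apery n) - + 2) (sym p⁵≡P⁵) (divides-difference [2p]Cp*apery≡2)

open import Defs
open import Data.Nat using (ℕ; _*_; _^_; _≥_; _∸_)
open import Data.Nat.Combinatorics using (_C_)
open import Data.Nat.Primality using (Prime)
open import Data.Integer using (+_; _-_)
open import Data.Integer.Divisibility using (_∣_)
open import Data.Integer.Divisibility.Signed using (∣⇒∣ᵤ)

mainTheorem2 : (p : ℕ) → Prime p → p ≥ 7 →
    (+ (p ^ 5)) ∣ ((+ (((2 * p) C p) * apery (p ∸ 1))) - (+ 2))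
mainTheorem2 p p-prime p≥7 with even-or-odd p
... | inj₂ (m , refl) = ∣⇒∣ᵤ (OddPrime.p⁵∣[2p]Cp*apery-2 m p-prime (7≤2m+1⇒3≤m m p≥7))
... | inj₁ (m , refl) with prime⇒irreducible p-prime (2∣double m)
...   | inj₁ ()
...   | inj₂ 2≡p = contradiction 2≡p (ℕ.<⇒≢ (ℕ.≤-trans (s≤s (s≤s (s≤s z≤n))) p≥7))
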